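{- Let $f$ be a comparator network of order $n$ that is a selection network for parameter $k$, half encoded as $\phi(f)$. Assume exactly $k-1$ input variables are set to true, the other variables were initially undefined, and unit propagation has been performed. Let $\bar z_x=\langle z_1,\dots,z_m\rangle$ be a propagation path. Then for each $1\le i\le m$: if $\langle z'_1,\dots,z'_{m'}\rangle$ with $z'_1=z_i$ is a path that would be set to true by unit propagation if we set $z'_1$ to true, then $\langle z'_1,\dots,z'_{m'}\rangle=\langle z_i,\dots,z_m\rangle$.
   Context: A comparator $c_{i,j}$ ($i<j$) puts the maximum of the entries at positions $i,j$ into position $i$ and the minimum into position $j$; a comparator network of order $n$ is a finite sequence of comparators. $f$ is a selection network for $k$ if for every input its output satisfies $y_1\ge\dots\ge y_k$ and $y_i\ge y_j$ for $i\le k<j$. Half encoding: position $i$ initially carries the boolean input variable $x_i$; a comparator $c_{i,j}$ with current variables $a$ (position $i$), $b$ (position $j$) introduces fresh output variables $c$ (position $i$), $d$ (position $j$) and clauses $(\neg a\vee c)\wedge(\neg b\vee c)\wedge(\neg a\vee\neg b\vee d)$; outputs $y_1,\dots,y_n$ are the final variables of the positions; $\phi(f)$ is the conjunction of all clauses. Unit propagation (UP) repeatedly sets to true the only undefined literal of a clause whose other literals are false. A path is a sequence $\langle z_1,\dots,z_m\rangle$ of variables of $\phi(f)$ such that for every $1\le i<m$ some comparator has inputs $a,b$ and outputs $c,d$ with $z_i\in\{a,b\}$, $z_{i+1}\in\{c,d\}$. For an undefined input variable $x$, a path $\bar z_x=\langle z_1,\dots,z_m\rangle$ ($m\ge1$)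 is a propagation path if $z_1=x$ and $\langle z_2,\dots,z_m\rangle$ is the sequence of variables that UP would set to true if we additionally set $z_1$ to true. -}

module Defs where

open import Data.Nat using (ℕ; zero; suc; _≤_; _<_; _⊔_; _⊓_; _∸_)
open import Data.Fin as Fin using (Fin; toℕ; _≟_)
open import Data.Fin.Subset using (Subset; _∈_; ∣_∣)
open import Data.List using (List; []; _∷_; length; lookup; take)
open import Data.List.Membership.Propositional as L using ()
open import Data.Product using (Σ; _×_; _,_)
open import Data.Sum using (_⊎_)
open import Relation.Nullary using (¬_; yes; no)
open import Relation.Binary.PropositionalEquality using (_≡_)
open import Level using (0ℓ)

record Comparator (n : ℕ) : Set where
  constructor comp
  field
    top : Fin n      -- i : receives the maximum
    bot : Fin n      -- j : receives the minimum
    lt  : top Fin.< bot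
open Comparator public

Network : ℕ → Set
Network n = List (Comparator n)

-- Value semantics (inputs from a totally ordered set, here ℕ).
applyComp : ∀ {n} → Comparator n → (Fin n → ℕ) → (Fin n → ℕ)
applyComp c v p with p ≟ top c
... | yes _ = v (top c) ⊔ v (bot c)
... | no _ with p ≟ bot c
...   | yes _ = v (top c) ⊓ v (bot c)
...   | no _ = v p

eval : ∀ {n} → Network n → (Fin n → ℕ) → (Fin n → ℕ)
eval [] v = v
eval (c ∷ cs) v = eval cs (applyComp c v)

-- Selection network for k (1-indexed y_1..y_n become positions 0..n-1):
-- y_1 ≥ … ≥ y_k  and  y_i ≥ y_j for i ≤ k < j.
IsSelectionNetwork : ∀ {n} → ℕ → Network n → Set
IsSelectionNetwork {n} k f =
  ∀ (x : Fin n → ℕ) →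
    (∀ (a b : Fin n) → toℕ a < toℕ b → toℕ b < k → eval f x b ≤ eval f x a)
    × (∀ (a b : Fin n) → toℕ a < k → k ≤ toℕ b → eval f x b ≤ eval f x a)

-- input p = x_p ; topV t / botV t = output variables c / d of the t-th
-- comparator (0-indexed in the sequence).
data Var (n : ℕ) : Set where
  input : Fin n → Var n
  topV  : ℕ → Var n
  botV  : ℕ → Var n

run : ∀ {n} → ℕ → List (Comparator n) → (Fin n → Var n) → (Fin n → Var n)
run t [] σ = σ
run t (c ∷ cs) σ = run (suc t) cs upd
  where
  upd : _ → Var _
  upd p with p ≟ top c
  ... | yes _ = topV t
  ... | no _ with p ≟ bot c
  ...   | yes _ = botV t
  ...   | no _ = σ p

before : ∀ {n} → Network n → ℕ → (Fin n → Var n)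
before f t = run 0 (take t f) input

inA inB : ∀ {n} (f : Network n) → Fin (length f) → Var n
inA f t = before f (toℕ t) (top (lookup f t))
inB f t = before f (toℕ t) (bot (lookup f t))

-- Every clause of φ(f) has exactly one positive literal and no variable is
-- ever set to false, so an assignment reached here is described by the
-- set of variables set to true; all others are undefined.

VSet : ℕ → Set₁
VSet n = Var n → Set

_∪₁_ : ∀ {n} → VSet n → Var n → VSet n
(S ∪₁ v) w = S w ⊎ w ≡ v

_∪L_ : ∀ {n} → VSet n → List (Var n) → VSet n
(S ∪L vs) w = S w ⊎ w L.∈ vs

-- v is the only undefined literal of some clause of φ(f) whose other
-- literals are false under the assignment S:
--   (¬a ∨ c), (¬b ∨ c) with a or b true  →  c ;
--   (¬a ∨ ¬b ∨ d) with a and b true      →  d.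
Forced : ∀ {n} → Network n → VSet n → Var n → Set
Forced f S v =
  Σ (Fin (length f)) λ t →
      (v ≡ topV (toℕ t) × (S (inA f t) ⊎ S (inB f t)))
    ⊎ (v ≡ botV (toℕ t) × S (inA f t) × S (inB f t))

data UPSeq {n : ℕ} (f : Network n) : VSet n → List (Var n) → Set₁ where
  done : ∀ {S} → (∀ v → Forced f S v → S v) → UPSeq f S []
  step : ∀ {S v vs} → ¬ S v → Forced f S v → UPSeq f (S ∪₁ v) vs →
         UPSeq f S (v ∷ vs)

Linked : ∀ {n} → Network n → Var n → Var n → Set
Linked f u w =
  Σ (Fin (length f)) λ t →
    (u ≡ inA f t ⊎ u ≡ inB f t) × (w ≡ topV (toℕ t) ⊎ w ≡ botV (toℕ t))

IsPath : ∀ {n} → Network n → List (Var n) → Set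
IsPath f [] = Data.Empty.⊥ where import Data.Empty
IsPath f (z ∷ []) = Data.Unit.⊤ where import Data.Unit
IsPath f (z ∷ w ∷ zs) = Linked f z w × IsPath f (w ∷ zs)

PropPathFrom : ∀ {n} → Network n → VSet n → Var n → List (Var n) → Set₁
PropPathFrom f T z zs =
  Σ (List (Var _)) λ rest →
    Lift₁ (zs ≡ z ∷ rest) × Lift₁ (IsPath f zs) × UPSeq f (T ∪₁ z) rest
  where
  Lift₁ : Set → Set₁
  Lift₁ A = Level.Lift (Level.suc 0ℓ) A

Init : ∀ {n} → Subset n → VSet n
Init I v = Σ (Fin _) λ p → v ≡ input p × p ∈ I

-- In the half encoding every variable is an input of at most one comparator, and an
-- output of comparator t can only be consumed by a later comparator. Hence, after
-- setting one more variable w on top of a UP-closed assignment T, the only clauses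
-- that can fire belong to the comparator consuming w, and at most one of its outputs
-- can become newly true: if the bottom output d is forced, both inputs are true, so one
-- of them lies in T and the top output c is already in T. Unit propagation therefore
-- walks a single chain through increasingly numbered comparators. Along that chain the
-- state reached at z_i has exactly the same pending (forced but unset) variables as
-- T ∪ {z_i}, so both continue with the same sequence z_{i+1}, …, z_m.

module Submission where

open import Defs
open import Data.Nat using (ℕ; suc; _≤_; _<_; _+_; _∸_; _⊓_; s≤s)
open import Data.Nat.Properties
  using (n<1+n; n≤1+n; <-≤-trans; <-trans; <-irrefl; <-asym; <-cmp; <⇒≤;
         +-suc; +-identityʳ; m⊓n≤m; m≤n⇒m⊓n≡m)
open import Data.Fin as Fin using (Fin; toℕ; zero; suc)
import Data.Fin.Properties as Fin
open import Data.Fin.Subset using (Subset; ∣_∣)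
open import Data.List using (List; []; _∷_; _++_; length; lookup; take; drop)
open import Data.List.Properties using (length-take)
open import Data.List.Relation.Unary.Any using (here; there)
open import Data.Product using (Σ; ∃; _×_; _,_; proj₂; map₂)
open import Data.Sum as Sum using (_⊎_; inj₁; inj₂; [_,_]′; map₁)
open import Data.Unit using (⊤; tt)
open import Data.Empty using (⊥; ⊥-elim)
open import Function using (case_of_; id; _∘_)
open import Function.Definitions using (Injective)
open import Level using (lift)
open import Relation.Nullary using (¬_; yes; no)
open import Relation.Unary using (_⊆_)
open import Relation.Binary using (tri<; tri≈; tri>)
open import Relation.Binary.PropositionalEquality
open ≡-Reasoning

module _ {n : ℕ} where

  CreatedBefore : ℕ → Var n → Set
  CreatedBefore m (input _) = ⊤
  CreatedBefore m (topV t)  = t < m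
  CreatedBefore m (botV t)  = t < m

  Output : ℕ → Var n → Set
  Output t v = v ≡ topV t ⊎ v ≡ botV t

  AllCreatedBefore : ℕ → (Fin n → Var n) → Set
  AllCreatedBefore m σ = ∀ p → CreatedBefore m (σ p)

  created-mono : ∀ {m m′} v → m ≤ m′ → CreatedBefore m v → CreatedBefore m′ v
  created-mono (input _) _    _  = tt
  created-mono (topV _)  m≤m′ lt = <-≤-trans lt m≤m′
  created-mono (botV _)  m≤m′ lt = <-≤-trans lt m≤m′

  created⇒¬output : ∀ {t v} → CreatedBefore t v → ¬ Output t v
  created⇒¬output lt (inj₁ refl) = <-irrefl refl lt
  created⇒¬output lt (inj₂ refl) = <-irrefl refl lt

  runComp : ℕ → Comparator n → (Fin n → Var n) → Fin n → Var n
  runComp t c = run t (c ∷ [])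

  data RunCompView (t : ℕ) (c : Comparator n) (σ : Fin n → Var n) (p : Fin n) :
                   Var n → Set where
    at-top    : p ≡ top c → RunCompView t c σ p (topV t)
    at-bot    : p ≡ bot c → RunCompView t c σ p (botV t)
    elsewhere : p ≢ top c → p ≢ bot c → RunCompView t c σ p (σ p)

  runCompView : ∀ t c σ p → RunCompView t c σ p (runComp t c σ p)
  runCompView t c σ p with p Fin.≟ top c
  ... | yes p≡top = at-top p≡top
  ... | no p≢top with p Fin.≟ bot c
  ...   | yes p≡bot = at-bot p≡bot
  ...   | no p≢bot  = elsewhere p≢top p≢bot

  runComp-created : ∀ {t} c {σ} → AllCreatedBefore t σ →
                    AllCreatedBefore (suc t) (runComp t c σ)
  runComp-created {t} c {σ} old p with runComp t c σ p | runCompView t c σ p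
  ... | _ | at-top _      = n<1+n t
  ... | _ | at-bot _      = n<1+n t
  ... | _ | elsewhere _ _ = created-mono (σ p) (n≤1+n t) (old p)

  runComp-keeps-old : ∀ {t} c {σ w} q → CreatedBefore t w → runComp t c σ q ≡ w →
                      q ≢ top c × q ≢ bot c × σ q ≡ w
  runComp-keeps-old {t} c {σ} q old e with runComp t c σ q | runCompView t c σ q
  ... | _ | at-top _              = ⊥-elim (created⇒¬output old (inj₁ (sym e)))
  ... | _ | at-bot _              = ⊥-elim (created⇒¬output old (inj₂ (sym e)))
  ... | _ | elsewhere q≢top q≢bot = q≢top , q≢bot , e

  runComp-injective : ∀ {t} c {σ} → AllCreatedBefore t σ → Injective _≡_ _≡_ σ →
                      Injective _≡_ _≡_ (runComp t c σ)
  runComp-injective {t} c {σ} old inj {p} {q} e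
    with runComp t c σ p | runCompView t c σ p | runComp t c σ q | runCompView t c σ q
  ... | _ | at-top p≡top  | _ | at-top q≡top  = trans p≡top (sym q≡top)
  ... | _ | at-bot p≡bot  | _ | at-bot q≡bot  = trans p≡bot (sym q≡bot)
  ... | _ | elsewhere _ _ | _ | elsewhere _ _ = inj e
  ... | _ | at-top _      | _ | at-bot _      = case e of λ ()
  ... | _ | at-bot _      | _ | at-top _      = case e of λ ()
  ... | _ | elsewhere _ _ | _ | at-top _      = ⊥-elim (created⇒¬output (old p) (inj₁ e))
  ... | _ | elsewhere _ _ | _ | at-bot _      = ⊥-elim (created⇒¬output (old p) (inj₂ e))
  ... | _ | at-top _      | _ | elsewhere _ _ = ⊥-elim (created⇒¬output (old q) (inj₁ (sym e)))
  ... | _ | at-bot _      | _ | elsewhere _ _ = ⊥-elim (created⇒¬output (old q) (inj₂ (sym e)))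

  runComp-consumes : ∀ {t} c {σ} → AllCreatedBefore t σ → Injective _≡_ _≡_ σ →
                     ∀ {p} → p ≡ top c ⊎ p ≡ bot c → ∀ q → runComp t c σ q ≢ σ p
  runComp-consumes c old inj {p} p∈c q e with runComp-keeps-old c q (old p) e
  ... | q≢top , q≢bot , σq≡σp with inj σq≡σp
  ...   | refl = [ q≢top , q≢bot ]′ p∈c

  run-created : ∀ {t} xs {σ} → AllCreatedBefore t σ →
                AllCreatedBefore (length xs + t) (run t xs σ)
  run-created []           old = old
  run-created {t} (c ∷ xs) {σ} old =
    subst (λ m → AllCreatedBefore m (run t (c ∷ xs) σ)) (+-suc (length xs) t)
          (run-created xs (runComp-created c old))

  run-injective : ∀ {t} xs {σ} → AllCreatedBefore t σ → Injective _≡_ _≡_ σ →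
                  Injective _≡_ _≡_ (run t xs σ)
  run-injective []       _   inj = inj
  run-injective (c ∷ xs) old inj =
    run-injective xs (runComp-created c old) (runComp-injective c old inj)

  run-avoids : ∀ {t} ys {σ w} → CreatedBefore t w → (∀ q → σ q ≢ w) → ∀ q → run t ys σ q ≢ w
  run-avoids []           _   absent = absent
  run-avoids {t} (c ∷ ys) {w = w} old absent =
    run-avoids ys (created-mono w (n≤1+n t) old)
      λ q e → absent q (proj₂ (proj₂ (runComp-keeps-old c q old e)))

  run-++ : ∀ {t} xs ys σ → run t (xs ++ ys) σ ≡ run (length xs + t) ys (run t xs σ)
  run-++ []           ys σ = refl
  run-++ {t} (c ∷ xs) ys σ =
    trans (run-++ xs ys (runComp t c σ))
          (cong (λ m → run m ys (run (suc t) xs (runComp t c σ))) (+-suc (length xs) t))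

take-split : ∀ {A : Set} (xs : List A) (s : Fin (length xs)) {m} → toℕ s < m →
             ∃ λ ys → take m xs ≡ take (toℕ s) xs ++ lookup xs s ∷ ys
take-split (x ∷ xs) zero    {suc m} _        = take m xs , refl
take-split (x ∷ xs) (suc s) {suc m} (s≤s lt) = map₂ (cong (x ∷_)) (take-split xs s lt)

lookup∷drop-suc : ∀ {A : Set} (xs : List A) (i : Fin (length xs)) →
                  lookup xs i ∷ drop (suc (toℕ i)) xs ≡ drop (toℕ i) xs
lookup∷drop-suc (x ∷ xs) zero    = refl
lookup∷drop-suc (x ∷ xs) (suc i) = lookup∷drop-suc xs i

module _ {n : ℕ} (f : Network n) where

  data Input (s : Fin (length f)) (w : Var n) : Set where
    is-inA : w ≡ inA f s → Input s w
    is-inB : w ≡ inB f s → Input s w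

  before-created : ∀ m → AllCreatedBefore m (before f m)
  before-created m p = created-mono (before f m p) bound (run-created (take m f) (λ _ → tt) p)
    where
    bound : length (take m f) + 0 ≤ m
    bound rewrite +-identityʳ (length (take m f)) | length-take m f = m⊓n≤m m (length f)

  before-injective : ∀ m → Injective _≡_ _≡_ (before f m)
  before-injective m = run-injective (take m f) (λ _ → tt) λ { refl → refl }

  before-split : ∀ s {m} → toℕ s < m →
                 ∃ λ ys → before f m ≡
                          run (suc (toℕ s)) ys (runComp (toℕ s) (lookup f s) (before f (toℕ s)))
  before-split s {m} lt with take-split f s lt
  ... | ys , take≡ = ys , (begin
    run 0 (take m f) input                                    ≡⟨ cong (λ xs → run 0 xs input) take≡ ⟩
    run 0 (take (toℕ s) f ++ c ∷ ys) input                    ≡⟨ run-++ (take (toℕ s) f) _ input ⟩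
    run (length (take (toℕ s) f) + 0) (c ∷ ys) (before f (toℕ s))
      ≡⟨ cong (λ t → run t (c ∷ ys) (before f (toℕ s))) index ⟩
    run (toℕ s) (c ∷ ys) (before f (toℕ s))                   ∎)
    where
    c = lookup f s
    index : length (take (toℕ s) f) + 0 ≡ toℕ s
    index = begin
      length (take (toℕ s) f) + 0 ≡⟨ +-identityʳ _ ⟩
      length (take (toℕ s) f)     ≡⟨ length-take (toℕ s) f ⟩
      toℕ s ⊓ length f            ≡⟨ m≤n⇒m⊓n≡m (<⇒≤ (Fin.toℕ<n s)) ⟩
      toℕ s                       ∎

  inputs-distinct : ∀ t → inA f t ≢ inB f t
  inputs-distinct t e = Fin.<-irrefl (before-injective (toℕ t) e) (lt (lookup f t))

  input-created : ∀ {s w} → Input s w → CreatedBefore (toℕ s) w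
  input-created (is-inA refl) = before-created _ _
  input-created (is-inB refl) = before-created _ _

  output-precedes-input : ∀ {t s v} → Output t v → Input s v → t < toℕ s
  output-precedes-input (inj₁ refl) vs = input-created vs
  output-precedes-input (inj₂ refl) vs = input-created vs

  input-position : ∀ {s w} → Input s w →
                   ∃ λ p → (p ≡ top (lookup f s) ⊎ p ≡ bot (lookup f s)) × before f (toℕ s) p ≡ w
  input-position (is-inA refl) = _ , inj₁ refl , refl
  input-position (is-inB refl) = _ , inj₂ refl , refl

  consumed-once : ∀ {w s s′} → Input s w → Input s′ w → toℕ s < toℕ s′ → ⊥
  consumed-once {s = s} {s′} ws ws′ s<s′
    with input-position ws | input-position ws′ | before-split s {toℕ s′} s<s′
  ... | p , p∈c , refl | q , _ , σ′q≡w | ys , split =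
    run-avoids ys (created-mono _ (n≤1+n (toℕ s)) (before-created (toℕ s) p))
      (runComp-consumes (lookup f s) (before-created (toℕ s)) (before-injective (toℕ s)) p∈c)
      q (trans (sym (cong (λ σ → σ q) split)) σ′q≡w)

  consumer-unique : ∀ {w s s′} → Input s w → Input s′ w → s ≡ s′
  consumer-unique {s = s} {s′} ws ws′ with <-cmp (toℕ s) (toℕ s′)
  ... | tri< s<s′ _ _ = ⊥-elim (consumed-once ws ws′ s<s′)
  ... | tri≈ _ s≡s′ _ = Fin.toℕ-injective s≡s′
  ... | tri> _ _ s′<s = ⊥-elim (consumed-once ws′ ws s′<s)

  forced-∪₁ : ∀ {S T : VSet n} {v u} → (∀ {b} s → S b → Input s b → Input s v → T b) →
              Forced f (S ∪₁ v) u → Forced f S u ⊎ Forced f (T ∪₁ v) u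
  forced-∪₁ _ (s , inj₁ (e , inj₁ (inj₁ a))) = inj₁ (s , inj₁ (e , inj₁ a))
  forced-∪₁ _ (s , inj₁ (e , inj₁ (inj₂ a))) = inj₂ (s , inj₁ (e , inj₁ (inj₂ a)))
  forced-∪₁ _ (s , inj₁ (e , inj₂ (inj₁ b))) = inj₁ (s , inj₁ (e , inj₂ b))
  forced-∪₁ _ (s , inj₁ (e , inj₂ (inj₂ b))) = inj₂ (s , inj₁ (e , inj₂ (inj₂ b)))
  forced-∪₁ _ (s , inj₂ (e , inj₁ a , inj₁ b)) = inj₁ (s , inj₂ (e , a , b))
  forced-∪₁ _ (s , inj₂ (e , inj₂ a , inj₂ b)) = inj₂ (s , inj₂ (e , inj₂ a , inj₂ b))
  forced-∪₁ other (s , inj₂ (e , inj₂ a , inj₁ b)) =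
    inj₂ (s , inj₂ (e , inj₂ a , inj₁ (other s b (is-inB refl) (is-inA (sym a)))))
  forced-∪₁ other (s , inj₂ (e , inj₁ a , inj₂ b)) =
    inj₂ (s , inj₂ (e , inj₁ (other s a (is-inA refl) (is-inB (sym b))) , inj₂ b))

Forced-mono : ∀ {n} (f : Network n) {S S′ : VSet n} → S ⊆ S′ → Forced f S ⊆ Forced f S′
Forced-mono f S⊆S′ (t , inj₁ (e , a⊎b)) = t , inj₁ (e , Sum.map S⊆S′ S⊆S′ a⊎b)
Forced-mono f S⊆S′ (t , inj₂ (e , a , b)) = t , inj₂ (e , S⊆S′ a , S⊆S′ b)

Closed : ∀ {n} → Network n → VSet n → Set
Closed f S = ∀ v → Forced f S v → S v

Pending : ∀ {n} → Network n → VSet n → VSet n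
Pending f S v = Forced f S v × ¬ S v

module _ {n : ℕ} {S : VSet n} {w : Var n} {vs : List (Var n)} where

  ∪L-∷⁺ : S ∪L (w ∷ vs) ⊆ (S ∪₁ w) ∪L vs
  ∪L-∷⁺ (inj₁ s)         = inj₁ (inj₁ s)
  ∪L-∷⁺ (inj₂ (here e))  = inj₁ (inj₂ e)
  ∪L-∷⁺ (inj₂ (there m)) = inj₂ m

  ∪L-∷⁻ : (S ∪₁ w) ∪L vs ⊆ S ∪L (w ∷ vs)
  ∪L-∷⁻ (inj₁ (inj₁ s)) = inj₁ s
  ∪L-∷⁻ (inj₁ (inj₂ e)) = inj₂ (here e)
  ∪L-∷⁻ (inj₂ m)        = inj₂ (there m)

∪L-[] : ∀ {n} {S : VSet n} → S ∪L [] ⊆ S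
∪L-[] (inj₁ s) = s
∪L-[] (inj₂ ())

UPSeq-closed : ∀ {n} {f : Network n} {S vs} → UPSeq f S vs → Closed f (S ∪L vs)
UPSeq-closed {f = f} {S} (done closed) v fv =
  inj₁ (closed v (Forced-mono f {S ∪L []} {S} (∪L-[] {S = S}) fv))
UPSeq-closed {f = f} {S} (step {v = w} {vs} _ _ r) v fv =
  ∪L-∷⁻ {S = S} (UPSeq-closed r v
    (Forced-mono f {S ∪L (w ∷ vs)} {(S ∪₁ w) ∪L vs} (∪L-∷⁺ {S = S}) fv))

module Propagation {n : ℕ} (f : Network n) {T : VSet n} (T-closed : Closed f T) where

  data NewlyForced (w v : Var n) : Set where
    via-top : ∀ t → Input f t w → v ≡ topV (toℕ t) → NewlyForced w v
    via-bot : ∀ t → Input f t w → v ≡ botV (toℕ t) →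
              (T ∪₁ w) (inA f t) → (T ∪₁ w) (inB f t) → NewlyForced w v

  pending-cases : ∀ {w v} → Pending f (T ∪₁ w) v → NewlyForced w v
  pending-cases ((t , inj₁ (e , inj₁ (inj₂ a))) , _) = via-top t (is-inA (sym a)) e
  pending-cases ((t , inj₁ (e , inj₂ (inj₂ b))) , _) = via-top t (is-inB (sym b)) e
  pending-cases ((t , inj₂ (e , inj₂ a , b)) , _) = via-bot t (is-inA (sym a)) e (inj₂ a) b
  pending-cases ((t , inj₂ (e , a , inj₂ b)) , _) = via-bot t (is-inB (sym b)) e a (inj₂ b)
  pending-cases ((t , inj₁ (e , inj₁ (inj₁ a))) , nv) =
    ⊥-elim (nv (inj₁ (T-closed _ (t , inj₁ (e , inj₁ a)))))
  pending-cases ((t , inj₁ (e , inj₂ (inj₁ b))) , nv) =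
    ⊥-elim (nv (inj₁ (T-closed _ (t , inj₁ (e , inj₂ b)))))
  pending-cases ((t , inj₂ (e , inj₁ a , inj₁ b)) , nv) =
    ⊥-elim (nv (inj₁ (T-closed _ (t , inj₂ (e , a , b)))))

  newly-forced-edge : ∀ {w v} → NewlyForced w v → ∃ λ t → Input f t w × Output (toℕ t) v
  newly-forced-edge (via-top t wt e)     = t , wt , inj₁ e
  newly-forced-edge (via-bot t wt e _ _) = t , wt , inj₂ e

  top-in-T : ∀ {w} t → (T ∪₁ w) (inA f t) → (T ∪₁ w) (inB f t) → T (topV (toℕ t))
  top-in-T t (inj₁ a) _        = T-closed _ (t , inj₁ (refl , inj₁ a))
  top-in-T t (inj₂ _) (inj₁ b) = T-closed _ (t , inj₁ (refl , inj₂ b))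
  top-in-T t (inj₂ a) (inj₂ b) = ⊥-elim (inputs-distinct f t (trans a (sym b)))

  pending-unique : ∀ {w u v} → Pending f (T ∪₁ w) u → Pending f (T ∪₁ w) v → u ≡ v
  pending-unique pu pv with pending-cases pu | pending-cases pv
  ... | via-top _ wt refl     | via-top _ wt′ refl     = cong (topV ∘ toℕ) (consumer-unique f wt wt′)
  ... | via-bot _ wt refl _ _ | via-bot _ wt′ refl _ _ = cong (botV ∘ toℕ) (consumer-unique f wt wt′)
  ... | via-top _ wt refl     | via-bot t wt′ refl a b with consumer-unique f wt wt′
  ...   | refl = ⊥-elim (proj₂ pu (inj₁ (top-in-T t a b)))
  pending-unique pu pv | via-bot t wt refl a b | via-top _ wt′ refl with consumer-unique f wt wt′
  ...   | refl = ⊥-elim (proj₂ pv (inj₁ (top-in-T t a b)))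

  -- The state reached along the propagation chain at w: to UP it looks like T ∪₁ w, and
  -- outside T it touches no comparator later than the one consuming w.
  record Mimics (S : VSet n) (w : Var n) : Set₁ where
    field
      extends         : T ∪₁ w ⊆ S
      pending⇒        : Pending f S ⊆ Pending f (T ∪₁ w)
      pending⇐        : Pending f (T ∪₁ w) ⊆ Pending f S
      later-inputs-T  : ∀ {b s s′} → S b → Input f s b → Input f s′ w → toℕ s′ < toℕ s → T b
      later-outputs-T : ∀ {b} {s s′ : Fin (length f)} →
                        S b → Output (toℕ s) b → Input f s′ w → toℕ s′ < toℕ s → T b
  open Mimics

  mimics-start : ∀ w → Mimics (T ∪₁ w) w
  mimics-start w = record
    { extends         = id
    ; pending⇒        = id
    ; pending⇐        = id
    ; later-inputs-T  = inputs
    ; later-outputs-T = outputs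
    }
    where
    inputs : ∀ {b s s′} → (T ∪₁ w) b → Input f s b → Input f s′ w → toℕ s′ < toℕ s → T b
    inputs (inj₁ tb)   _  _   _     = tb
    inputs (inj₂ refl) bs ws′ s′<s = ⊥-elim (<-irrefl (cong toℕ (consumer-unique f ws′ bs)) s′<s)

    outputs : ∀ {b} {s s′ : Fin (length f)} →
              (T ∪₁ w) b → Output (toℕ s) b → Input f s′ w → toℕ s′ < toℕ s → T b
    outputs (inj₁ tb)   _  _   _     = tb
    outputs (inj₂ refl) bs ws′ s′<s = ⊥-elim (<-asym s′<s (output-precedes-input f bs ws′))

  mimics-step : ∀ {S w v} → Mimics S w → Pending f S v → Mimics (S ∪₁ v) v
  mimics-step {S} {w} {v} M pv with newly-forced-edge (pending-cases (pending⇒ M pv))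
  ... | t , wt , vt = record
    { extends         = T∪v⊆S∪v
    ; pending⇒        = pending⇒′
    ; pending⇐        = pending⇐′
    ; later-inputs-T  = inputs
    ; later-outputs-T = outputs
    }
    where
    T∪v⊆S∪v : T ∪₁ v ⊆ S ∪₁ v
    T∪v⊆S∪v = map₁ λ tx → extends M (inj₁ tx)

    other-input-T : ∀ {b} s → S b → Input f s b → Input f s v → T b
    other-input-T s sb bs vs = later-inputs-T M sb bs wt (output-precedes-input f vt vs)

    pending⇒′ : Pending f (S ∪₁ v) ⊆ Pending f (T ∪₁ v)
    pending⇒′ (fu , nu) with forced-∪₁ f other-input-T fu
    ... | inj₂ fu′ = fu′ , nu ∘ T∪v⊆S∪v
    ... | inj₁ fuS =
      ⊥-elim (nu (inj₂ (pending-unique (pending⇒ M (fuS , nu ∘ inj₁)) (pending⇒ M pv))))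

    pending⇐′ : Pending f (T ∪₁ v) ⊆ Pending f (S ∪₁ v)
    pending⇐′ (fu , nu) = Forced-mono f {T ∪₁ v} {S ∪₁ v} T∪v⊆S∪v fu , unset
      where
      unset : ¬ (S ∪₁ v) _
      unset (inj₂ refl) = nu (inj₂ refl)
      unset (inj₁ su) with newly-forced-edge (pending-cases (fu , nu))
      ... | s , vs , us = nu (inj₁ (later-outputs-T M su us wt (output-precedes-input f vt vs)))

    inputs : ∀ {b s s′} → (S ∪₁ v) b → Input f s b → Input f s′ v → toℕ s′ < toℕ s → T b
    inputs (inj₂ refl) bs vs′ s′<s = ⊥-elim (<-irrefl (cong toℕ (consumer-unique f vs′ bs)) s′<s)
    inputs (inj₁ sb)   bs vs′ s′<s =
      later-inputs-T M sb bs wt (<-trans (output-precedes-input f vt vs′) s′<s)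

    outputs : ∀ {b} {s s′ : Fin (length f)} → (S ∪₁ v) b → Output (toℕ s) b → Input f s′ v →
              toℕ s′ < toℕ s → T b
    outputs (inj₂ refl) bs vs′ s′<s = ⊥-elim (<-asym s′<s (output-precedes-input f bs vs′))
    outputs (inj₁ sb)   bs vs′ s′<s =
      later-outputs-T M sb bs wt (<-trans (output-precedes-input f vt vs′) s′<s)

  UPSeq-deterministic : ∀ {S S′ w vs vs′} → Mimics S w → Mimics S′ w →
                        UPSeq f S vs → UPSeq f S′ vs′ → vs ≡ vs′
  UPSeq-deterministic M M′ (done _) (done _) = refl
  UPSeq-deterministic M M′ (done closed) (step nv fv _) =
    let (fv , nv) = pending⇐ M (pending⇒ M′ (fv , nv)) in ⊥-elim (nv (closed _ fv))
  UPSeq-deterministic M M′ (step nv fv _) (done closed) =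
    let (fv , nv) = pending⇐ M′ (pending⇒ M (fv , nv)) in ⊥-elim (nv (closed _ fv))
  UPSeq-deterministic M M′ (step nv fv r) (step nv′ fv′ r′)
    with pending-unique (pending⇒ M (fv , nv)) (pending⇒ M′ (fv′ , nv′))
  ... | refl =
    cong (_ ∷_) (UPSeq-deterministic (mimics-step M (fv , nv)) (mimics-step M′ (fv′ , nv′)) r r′)

  mimics-along : ∀ {S w vs} → Mimics S w → UPSeq f S vs → (i : Fin (length (w ∷ vs))) →
                 Σ (VSet n) λ S′ → Mimics S′ (lookup (w ∷ vs) i) ×
                                   UPSeq f S′ (drop (suc (toℕ i)) (w ∷ vs))
  mimics-along {S} M r              zero    = S , M , r
  mimics-along     M (step nv fv r) (suc i) = mimics-along (mimics-step M (fv , nv)) r i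

  propagation-suffix : ∀ {w vs vs′} → UPSeq f (T ∪₁ w) vs → (i : Fin (length (w ∷ vs))) →
                       UPSeq f (T ∪₁ lookup (w ∷ vs) i) vs′ →
                       lookup (w ∷ vs) i ∷ vs′ ≡ drop (toℕ i) (w ∷ vs)
  propagation-suffix {w} {vs} {vs′} r i r′ with mimics-along (mimics-start w) r i
  ... | _ , M , rᵢ = begin
    lookup (w ∷ vs) i ∷ vs′
      ≡⟨ cong (lookup (w ∷ vs) i ∷_) (UPSeq-deterministic (mimics-start _) M r′ rᵢ) ⟩
    lookup (w ∷ vs) i ∷ drop (suc (toℕ i)) (w ∷ vs)
      ≡⟨ lookup∷drop-suc (w ∷ vs) i ⟩
    drop (toℕ i) (w ∷ vs)
      ∎

lemma13 : ∀ {n : ℕ} (k : ℕ) (f : Network n) → 1 ≤ k → IsSelectionNetwork k f →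
    (I : Subset n) → ∣ I ∣ ≡ k ∸ 1 →
    (ts : List (Var n)) → UPSeq f (Init I) ts →
    (x : Fin n) → ¬ ((Init I ∪L ts) (input x)) →
    (zs : List (Var n)) → PropPathFrom f (Init I ∪L ts) (input x) zs →
    (i : Fin (length zs)) (zs′ : List (Var n)) →
    PropPathFrom f (Init I ∪L ts) (lookup zs i) zs′ →
    zs′ ≡ drop (toℕ i) zs
lemma13 _ f _ _ _ _ _ upI _ _ _ (_ , lift refl , _ , up) i _ (_ , lift refl , _ , up′) =
  propagation-suffix up i up′
  where open Propagation f (UPSeq-closed upI)
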